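{- In the test-preemptive setting, consider the Two Phases algorithm, which has access to an exact (optimal) offline algorithm OFF for classical makespan minimization on $m$ identical machines. In the first phase, every job with $t_j\le u_j$ is scheduled to be tested (a piece of length $t_j$) and every job with $t_j>u_j$ is scheduled to be run untested (a piece of length $u_j$); i.e. every job $j$ receives a piece of length $\tau_j=\min(t_j,u_j)$, and these pieces are assigned to machines by OFF. In the second phase, all processing times $p_j$ of the tested jobs are known, and the execution pieces (of lengths $p_j$) of all tested jobs are assigned to machines by OFF; this second schedule is placed after the first, starting once the first phase is completed. Then the Two Phases algorithm is $2$-competitive for makespan minimization on $m$ identical machines with testing in the test-preemptive setting.
   Context: Scheduling with testing on $m$ identical parallel machines: there are $n$ jobs; each job $j$ has a testing time $t_j\ge 0$, an upper bound $u_j\ge 0$ and a processing time $p_j$ with $0\le p_j\le u_j$. A job can either be run untested, requiring time $u_j$, or be tested (time $t_j$) and then executed (time $p_j$); the value $p_j$ is revealed to the algorithm only when the test of $j$ is completed, and any part of the execution must take place after the test is completed. Initially the algorithm knows $m$, $n$ and all $t_j,u_j$, but not the $p_j$. Test-preemptive setting: an untested job must be run without interruption on a single machine; for a tested job, its test must be run without interruption on one machine and its execution must be run without interruption on one (possibly different) machine, starting no earlier than the completion of the test. The objective is the makespan. $\mathrm{OPT}$ denotes the optimal makespan of an offline scheduler knowing all $p_j$. An algorithm is $c$-competitive if its makespan $\mathrm{ALG}$ satisfies $\mathrm{ALG}\le c\cdot\mathrm{OPT}$ on every instance. The algorithm is assumed to have unlimited computational power.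
   Formalization: The testing times $t_j$, upper bounds $u_j$, processing times $p_j$ and the start times of the offline schedules that determine $\mathrm{OPT}$ are rational. -}

module Defs where

open import Data.Nat using (ℕ; zero; suc)
open import Data.Fin using (Fin; zero; suc; _≟_)
open import Data.Bool using (Bool; true; false; if_then_else_)
open import Data.Product using (_×_; _,_)
open import Data.Sum using (_⊎_)
open import Data.Rational using (ℚ; 0ℚ; 1ℚ; _+_; _≤_; _⊔_; _≤ᵇ_)
open import Relation.Nullary.Decidable using (⌊_⌋)
open import Relation.Binary.PropositionalEquality using (_≡_; _≢_)

-- Finite sums and maxima over Fin n (times are nonnegative, so a maximum
-- starting from 0 is the usual maximum; the empty maximum is 0).

sumFin : (n : ℕ) → (Fin n → ℚ) → ℚ
sumFin zero    f = 0ℚ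
sumFin (suc n) f = f zero + sumFin n (λ i → f (suc i))

maxFin : (n : ℕ) → (Fin n → ℚ) → ℚ
maxFin zero    f = 0ℚ
maxFin (suc n) f = f zero ⊔ maxFin n (λ i → f (suc i))

-- Classical makespan minimisation on m identical machines (the problem
-- solved by OFF): n pieces of lengths w j are assigned by σ to machines;
-- pieces on one machine are processed back to back from time 0, so the
-- makespan is the maximum machine load.

load : (m n : ℕ) → (Fin n → ℚ) → (Fin n → Fin m) → Fin m → ℚ
load m n w σ i = sumFin n (λ j → if ⌊ σ j ≟ i ⌋ then w j else 0ℚ)

maxLoad : (m n : ℕ) → (Fin n → ℚ) → (Fin n → Fin m) → ℚ
maxLoad m n w σ = maxFin m (load m n w σ)

-- σ is an output of an exact offline algorithm OFF: its makespan is optimal.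
IsOptimalAssignment : (m n : ℕ) → (Fin n → ℚ) → (Fin n → Fin m) → Set
IsOptimalAssignment m n w σ = (σ′ : Fin n → Fin m) → maxLoad m n w σ ≤ maxLoad m n w σ′

record Instance (n : ℕ) : Set where
  field
    t u p  : Fin n → ℚ
    t≥0    : ∀ j → 0ℚ ≤ t j
    u≥0    : ∀ j → 0ℚ ≤ u j
    p≥0    : ∀ j → 0ℚ ≤ p j
    p≤u    : ∀ j → p j ≤ u j
open Instance public

-- For each job: whether it is tested; the machine/start of its first piece
-- (the test if tested, the untested run otherwise); and the machine/start of
-- its execution piece (only meaningful if the job is tested).

record Schedule (m n : ℕ) : Set where
  field
    tested  : Fin n → Bool
    mach₁   : Fin n → Fin m
    start₁  : Fin n → ℚ
    mach₂   : Fin n → Fin m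
    start₂  : Fin n → ℚ
open Schedule public

-- pieces: (j , false) = first piece of j, (j , true) = execution piece of j
Piece : ℕ → Set
Piece n = Fin n × Bool

module _ {m n : ℕ} (I : Instance n) (S : Schedule m n) where

  active : Piece n → Set
  active (j , false) = Data.Unit.⊤ where import Data.Unit
  active (j , true)  = tested S j ≡ true

  pMachine : Piece n → Fin m
  pMachine (j , false) = mach₁ S j
  pMachine (j , true)  = mach₂ S j

  pStart : Piece n → ℚ
  pStart (j , false) = start₁ S j
  pStart (j , true)  = start₂ S j

  pLength : Piece n → ℚ
  pLength (j , false) = if tested S j then t I j else u I j
  pLength (j , true)  = p I j

  pEnd : Piece n → ℚ
  pEnd a = pStart a + pLength a

  record Feasible : Set where
    field
      start₁≥0   : ∀ j → 0ℚ ≤ start₁ S j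
      testFirst  : ∀ j → tested S j ≡ true → start₁ S j + t I j ≤ start₂ S j
      disjoint   : ∀ a b → a ≢ b → active a → active b →
                   pMachine a ≡ pMachine b →
                   pEnd a ≤ pStart b ⊎ pEnd b ≤ pStart a

  completion : Fin n → ℚ
  completion j = if tested S j then start₂ S j + p I j else start₁ S j + u I j

  makespan : ℚ
  makespan = maxFin n completion

module _ {n : ℕ} (I : Instance n) where

  testsJob : Fin n → Bool
  testsJob j = t I j ≤ᵇ u I j

  τ : Fin n → ℚ
  τ j = if testsJob j then t I j else u I j

  -- phase 2 piece lengths: p j for tested jobs; untested jobs have no
  -- phase-2 piece (modelled as a piece of length 0, which does not affect
  -- any load)
  phase₂Length : Fin n → ℚ
  phase₂Length j = if testsJob j then p I j else 0ℚ

  -- makespan of Two Phases given OFF's assignments σ₁ (phase 1) and σ₂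
  -- (phase 2): phase 2 starts when phase 1 is completed.
  twoPhasesMakespan : (m : ℕ) → (Fin n → Fin m) → (Fin n → Fin m) → ℚ
  twoPhasesMakespan m σ₁ σ₂ = maxLoad m n τ σ₁ + maxLoad m n phase₂Length σ₂

2ℚ : ℚ
2ℚ = 1ℚ + 1ℚ

-- Fix a feasible offline schedule S with makespan M.  Giving every job its
-- first piece (test or untested run) in S yields a phase-1 assignment in
-- which each job is charged τ j ≤ the length of that piece; giving every job
-- its last piece in S (execution or untested run) yields a phase-2
-- assignment charging phase₂Length j ≤ p j ≤ the length of that piece.  The
-- pieces of S on one machine are pairwise disjoint intervals inside [0, M],
-- so both assignments have maximum load at most M, and since OFF is optimal
-- the two phases together take at most 2M.
module Submission where

open import Defs
open import Data.Nat using (ℕ; zero; suc; s≤s) renaming (_≤_ to _≤ℕ_)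
import Data.Nat.Properties as ℕ
open import Data.Fin using (Fin; zero; suc; _≟_)
open import Data.Bool using (Bool; true; false; if_then_else_; T)
open import Data.Product using (_×_; _,_; proj₁)
open import Data.Sum using (_⊎_; inj₁; inj₂)
open import Data.Unit using (tt)
open import Data.Empty using (⊥-elim)
open import Function using (_∘_; id)
open import Data.List using (List; []; _∷_; map; filter; length; tabulate; allFin)
open import Data.List.Relation.Unary.All as All using (All; []; _∷_)
import Data.List.Relation.Unary.All.Properties as All
open import Data.List.Relation.Unary.AllPairs as AllPairs using (AllPairs; []; _∷_)
import Data.List.Relation.Unary.AllPairs.Properties as AllPairs
open import Data.List.Relation.Unary.Unique.Propositional.Properties using (allFin⁺)
open import Data.List.Properties using (length-filter; map-tabulate)
open import Data.Rational using (ℚ; 0ℚ; 1ℚ; _+_; _*_; _≤_; _≤ᵇ_; _≤?_)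
open import Data.Rational.Properties
  using (≤-refl; ≤-trans; <⇒≤; ≰⇒>; ≤ᵇ⇒≤; ≤⇒≤ᵇ; +-mono-≤; +-monoʳ-≤; +-monoˡ-≤;
         +-assoc; +-0-commutativeMonoid; +-identityˡ; +-identityʳ;
         p≤p⊔q; p≤q⊔p; ⊔-lub; module ≤-Reasoning)
open import Algebra.Bundles using (CommutativeMonoid)
open import Algebra.Properties.CommutativeSemigroup
  (CommutativeMonoid.commutativeSemigroup +-0-commutativeMonoid) using (x∙yz≈y∙xz)
open import Data.Rational.Solver using (module +-*-Solver)
open import Relation.Nullary using (¬_; yes; no; ¬?)
open import Relation.Nullary.Decidable using (⌊_⌋)
open import Relation.Unary using (Decidable)
open import Relation.Binary.PropositionalEquality
  using (_≡_; _≢_; refl; sym; trans; cong; subst)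

x≤x+y : ∀ x {y} → 0ℚ ≤ y → x ≤ x + y
x≤x+y x {y} 0≤y = subst (_≤ x + y) (+-identityʳ x) (+-monoʳ-≤ x 0≤y)

2*x≡x+x : ∀ x → 2ℚ * x ≡ x + x
2*x≡x+x = solve 1 (λ x → (con 1ℚ :+ con 1ℚ) :* x := x :+ x) refl
  where open +-*-Solver

sumℚ : List ℚ → ℚ
sumℚ []       = 0ℚ
sumℚ (x ∷ xs) = x + sumℚ xs

module _ {A : Set} where

  sumℚ-mono : {f g : A → ℚ} {xs : List A} →
              All (λ x → f x ≤ g x) xs → sumℚ (map f xs) ≤ sumℚ (map g xs)
  sumℚ-mono []           = ≤-refl
  sumℚ-mono (fx≤gx ∷ ps) = +-mono-≤ fx≤gx (sumℚ-mono ps)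

  kept dropped : {P : A → Set} → Decidable P → (A → ℚ) → List A → ℚ
  kept    P? f xs = sumℚ (map f (filter P? xs))
  dropped P? f xs = sumℚ (map f (filter (¬? ∘ P?) xs))

  sumℚ-filter-partition : {P : A → Set} (P? : Decidable P) (f : A → ℚ) (xs : List A) →
    sumℚ (map f xs) ≡ kept P? f xs + dropped P? f xs
  sumℚ-filter-partition P? f [] = refl
  sumℚ-filter-partition P? f (x ∷ xs) with P? x
  ... | yes _ = trans (cong (f x +_) (sumℚ-filter-partition P? f xs))
                      (sym (+-assoc (f x) (kept P? f xs) (dropped P? f xs)))
  ... | no  _ = trans (cong (f x +_) (sumℚ-filter-partition P? f xs))
                      (x∙yz≈y∙xz (f x) (kept P? f xs) (dropped P? f xs))

  sumℚ-indicator : {P : A → Set} (P? : Decidable P) (f : A → ℚ) (xs : List A) →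
    sumℚ (map (λ x → if ⌊ P? x ⌋ then f x else 0ℚ) xs) ≡ sumℚ (map f (filter P? xs))
  sumℚ-indicator P? f [] = refl
  sumℚ-indicator P? f (x ∷ xs) with P? x
  ... | yes _ = cong (f x +_) (sumℚ-indicator P? f xs)
  ... | no  _ = trans (+-identityˡ _) (sumℚ-indicator P? f xs)

allPairs-discharge : {A : Set} {P : A → Set} {R : A → A → Set} {xs : List A} →
  All P xs → AllPairs (λ a b → P a → P b → R a b) xs → AllPairs R xs
allPairs-discharge []        []       = []
allPairs-discharge (pa ∷ ps) (h ∷ hs) =
  All.zipWith (λ { (r , pb) → r pa pb }) (h , ps) ∷ allPairs-discharge ps hs

sumFin≡sumℚ-allFin : ∀ n (f : Fin n → ℚ) → sumFin n f ≡ sumℚ (map f (allFin n))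
sumFin≡sumℚ-allFin n f = trans (tabulated n f) (cong sumℚ (sym (map-tabulate id f)))
  where
  tabulated : ∀ n (f : Fin n → ℚ) → sumFin n f ≡ sumℚ (tabulate f)
  tabulated zero    f = refl
  tabulated (suc n) f = cong (f zero +_) (tabulated n (f ∘ suc))

≤-maxFin : ∀ n (f : Fin n → ℚ) j → f j ≤ maxFin n f
≤-maxFin (suc n) f zero    = p≤p⊔q (f zero) _
≤-maxFin (suc n) f (suc j) = ≤-trans (≤-maxFin n (f ∘ suc) j) (p≤q⊔p (f zero) _)

maxFin-lub : ∀ n (f : Fin n → ℚ) {M} → 0ℚ ≤ M → (∀ i → f i ≤ M) → maxFin n f ≤ M
maxFin-lub zero    f 0≤M f≤M = 0≤M
maxFin-lub (suc n) f 0≤M f≤M = ⊔-lub (f≤M zero) (maxFin-lub n (f ∘ suc) 0≤M (f≤M ∘ suc))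

0≤maxFin : ∀ n (f : Fin n → ℚ) → 0ℚ ≤ maxFin n f
0≤maxFin zero    f = ≤-refl
0≤maxFin (suc n) f = ≤-trans (0≤maxFin n (f ∘ suc)) (p≤q⊔p (f zero) _)

module Intervals {A : Set} (left len : A → ℚ) where

  end : A → ℚ
  end a = left a + len a

  Disjoint : A → A → Set
  Disjoint a b = end a ≤ left b ⊎ end b ≤ left a

  Within : ℚ → ℚ → A → Set
  Within lo hi a = lo ≤ left a × end a ≤ hi

  -- The other intervals split into those ending before a starts, packed into
  -- [lo, left a], and those starting after a ends, packed into [end a, hi];
  -- the recursion on these filtered lists is justified by the length bound k.
  sum-disjoint-len≤ : ∀ {lo hi} (xs : List A) → AllPairs Disjoint xs →
                      All (Within lo hi) xs → lo ≤ hi → sumℚ (map len xs) + lo ≤ hi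
  sum-disjoint-len≤ xs = bounded (length xs) xs ℕ.≤-refl
    where
    bounded : ∀ {lo hi} k (xs : List A) → length xs ≤ℕ k → AllPairs Disjoint xs →
              All (Within lo hi) xs → lo ≤ hi → sumℚ (map len xs) + lo ≤ hi
    bounded {lo} {hi} k [] _ _ _ lo≤hi = subst (_≤ hi) (sym (+-identityˡ lo)) lo≤hi
    bounded {lo} {hi} (suc k) (a ∷ rest) (s≤s |rest|≤k) (a-disj ∷ rest-disj)
            ((lo≤a , a≤hi) ∷ rest-within) _ = begin
        (len a + sumℚ (map len rest)) + lo
          ≡⟨ cong (λ s → (len a + s) + lo) (sumℚ-filter-partition before? len rest) ⟩
        (len a + (sumℚ (map len before) + sumℚ (map len after))) + lo
          ≡⟨ rearrange (len a) (sumℚ (map len before)) (sumℚ (map len after)) lo ⟩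
        sumℚ (map len after) + ((sumℚ (map len before) + lo) + len a)
          ≤⟨ +-monoʳ-≤ (sumℚ (map len after)) (+-monoˡ-≤ (len a) before-fits) ⟩
        sumℚ (map len after) + end a
          ≤⟨ after-fits ⟩
        hi ∎
      where
      open ≤-Reasoning
      rearrange : ∀ a l r o → (a + (l + r)) + o ≡ r + ((l + o) + a)
      rearrange = solve 4 (λ a l r o → (a :+ (l :+ r)) :+ o := r :+ ((l :+ o) :+ a)) refl
        where open +-*-Solver
      before? : Decidable (λ b → end b ≤ left a)
      before? b = end b ≤? left a
      before after : List A
      before = filter before? rest
      after  = filter (¬? ∘ before?) rest

      before-fits : sumℚ (map len before) + lo ≤ left a
      before-fits =
        bounded k before (ℕ.≤-trans (length-filter before? rest) |rest|≤k)
          (AllPairs.filter⁺ before? rest-disj)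
          (All.zipWith (λ { ((lo≤b , _) , b≤a) → lo≤b , b≤a })
            (All.filter⁺ before? rest-within , All.all-filter before? rest))
          lo≤a

      after-within : ∀ {b} → (Within lo hi b × Disjoint a b) × ¬ end b ≤ left a →
                     Within (end a) hi b
      after-within (((_ , b≤hi) , inj₁ a≤b) , _) = a≤b , b≤hi
      after-within ((_ , inj₂ b≤a) , not-before) = ⊥-elim (not-before b≤a)

      after-fits : sumℚ (map len after) + end a ≤ hi
      after-fits =
        bounded k after (ℕ.≤-trans (length-filter (¬? ∘ before?) rest) |rest|≤k)
          (AllPairs.filter⁺ (¬? ∘ before?) rest-disj)
          (All.zipWith after-within
            (All.zip (All.filter⁺ (¬? ∘ before?) rest-within ,
                      All.filter⁺ (¬? ∘ before?) a-disj) ,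
             All.all-filter (¬? ∘ before?) rest))
          a≤hi

module _ {m n : ℕ} (I : Instance n) (S : Schedule m n) (F : Feasible I S) where

  open Feasible F

  active-pStart≥0 : ∀ {a} → active I S a → 0ℚ ≤ pStart I S a
  active-pStart≥0 {j , false} _        = start₁≥0 j
  active-pStart≥0 {j , true}  tested-j =
    ≤-trans (≤-trans (start₁≥0 j) (x≤x+y _ (t≥0 I j))) (testFirst j tested-j)

  pEnd≤completion : ∀ j b → active I S (j , b) → pEnd I S (j , b) ≤ completion I S j
  pEnd≤completion j false _ with tested S j in tested-j
  ... | true  = ≤-trans (testFirst j tested-j) (x≤x+y _ (p≥0 I j))
  ... | false = ≤-refl
  pEnd≤completion j true tested-j rewrite tested-j = ≤-refl

  maxLoad-pieces≤makespan : (which : Fin n → Bool) → (∀ j → active I S (j , which j)) →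
    (w : Fin n → ℚ) → (∀ j → w j ≤ pLength I S (j , which j)) →
    maxLoad m n w (λ j → pMachine I S (j , which j)) ≤ makespan I S
  maxLoad-pieces≤makespan which act w w≤len =
    maxFin-lub m (load m n w σ) (0≤maxFin n (completion I S)) load≤M
    where
    σ : Fin n → Fin m
    σ j = pMachine I S (j , which j)
    M : ℚ
    M = makespan I S
    open Intervals (λ j → pStart I S (j , which j)) (λ j → pLength I S (j , which j))

    load≤M : ∀ i → load m n w σ i ≤ M
    load≤M i = begin
        load m n w σ i
          ≡⟨ trans (sumFin≡sumℚ-allFin n _) (sumℚ-indicator on-i? w (allFin n)) ⟩
        sumℚ (map w on-i)
          ≤⟨ sumℚ-mono (All.filter⁺ on-i? {xs = allFin n} (All.tabulate (λ {j} _ → w≤len j))) ⟩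
        sumℚ (map (λ j → pLength I S (j , which j)) on-i)
          ≤⟨ subst (_≤ M) (+-identityʳ _) (sum-disjoint-len≤ on-i pairwise-disjoint within 0≤M) ⟩
        M ∎
      where
      open ≤-Reasoning
      0≤M : 0ℚ ≤ M
      0≤M = 0≤maxFin n (completion I S)
      on-i? : Decidable (λ j → σ j ≡ i)
      on-i? j = σ j ≟ i
      on-i : List (Fin n)
      on-i = filter on-i? (allFin n)

      within : All (Within 0ℚ M) on-i
      within = All.filter⁺ on-i? {xs = allFin n} (All.tabulate λ {j} _ →
        active-pStart≥0 (act j) ,
        ≤-trans (pEnd≤completion j (which j) (act j)) (≤-maxFin n (completion I S) j))

      disjoint-on-i : ∀ {j k} → j ≢ k → σ j ≡ i → σ k ≡ i → Disjoint j k
      disjoint-on-i j≢k σj≡i σk≡i =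
        disjoint _ _ (j≢k ∘ cong proj₁) (act _) (act _) (trans σj≡i (sym σk≡i))

      pairwise-disjoint : AllPairs Disjoint on-i
      pairwise-disjoint = allPairs-discharge (All.all-filter on-i? (allFin n))
                            (AllPairs.filter⁺ on-i? (AllPairs.map disjoint-on-i (allFin⁺ n)))

module _ {m n : ℕ} (I : Instance n) (S : Schedule m n) where

  τ≤first-piece : ∀ j → τ I j ≤ pLength I S (j , false)
  τ≤first-piece j with t I j ≤ᵇ u I j in t≤ᵇu | tested S j
  ... | true  | true  = ≤-refl
  ... | true  | false = ≤ᵇ⇒≤ (subst T (sym t≤ᵇu) tt)
  ... | false | true  = <⇒≤ (≰⇒> (λ t≤u → subst T t≤ᵇu (≤⇒≤ᵇ t≤u)))
  ... | false | false = ≤-refl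

  last-piece-active : ∀ j → active I S (j , tested S j)
  last-piece-active j with tested S j in tested-j
  ... | true  = tested-j
  ... | false = tt

  phase₂Length≤last-piece : ∀ j → phase₂Length I j ≤ pLength I S (j , tested S j)
  phase₂Length≤last-piece j = ≤-trans (phase₂Length≤p j) (p≤last-piece (tested S j) refl)
    where
    phase₂Length≤p : ∀ j → phase₂Length I j ≤ p I j
    phase₂Length≤p j with t I j ≤ᵇ u I j
    ... | true  = ≤-refl
    ... | false = p≥0 I j
    p≤last-piece : ∀ b → tested S j ≡ b → p I j ≤ pLength I S (j , b)
    p≤last-piece true  _          = ≤-refl
    p≤last-piece false untested-j rewrite untested-j = p≤u I j

theorem5 : (m n : ℕ) (I : Instance n) (σ₁ σ₂ : Fin n → Fin m) →
           IsOptimalAssignment m n (τ I) σ₁ →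
           IsOptimalAssignment m n (phase₂Length I) σ₂ →
           (S : Schedule m n) → Feasible I S →
           twoPhasesMakespan I m σ₁ σ₂ ≤ 2ℚ * makespan I S
theorem5 m n I σ₁ σ₂ opt₁ opt₂ S F = begin
    maxLoad m n (τ I) σ₁ + maxLoad m n (phase₂Length I) σ₂
      ≤⟨ +-mono-≤ (≤-trans (opt₁ first-machine) phase₁≤M)
                  (≤-trans (opt₂ last-machine) phase₂≤M) ⟩
    makespan I S + makespan I S
      ≡⟨ sym (2*x≡x+x (makespan I S)) ⟩
    2ℚ * makespan I S ∎
  where
  open ≤-Reasoning
  first-machine last-machine : Fin n → Fin m
  first-machine j = pMachine I S (j , false)
  last-machine  j = pMachine I S (j , tested S j)
  phase₁≤M : maxLoad m n (τ I) first-machine ≤ makespan I S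
  phase₁≤M = maxLoad-pieces≤makespan I S F (λ _ → false) (λ _ → tt) (τ I) (τ≤first-piece I S)
  phase₂≤M : maxLoad m n (phase₂Length I) last-machine ≤ makespan I S
  phase₂≤M = maxLoad-pieces≤makespan I S F (tested S) (last-piece-active I S)
               (phase₂Length I) (phase₂Length≤last-piece I S)
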